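{- Let $\mathbb{H}$ and $B$ be as in the context, let $0<\delta \leq 1/5$, and let $C \subseteq V$ be a $\delta$-clean set with $C\supseteq B$. If $\vert C \vert > \frac{1}{\delta}\vert B \vert$, then the number of $\langle - \rangle$ edges both of whose end-vertices lie in $C\setminus B$ is at most $2\cdot m_{\mathbb{H}}(\mathrm{OPT}(\mathbb{H}))$. Moreover, if $\vert C \vert > \frac{1}{\delta}\vert B \vert$ and $\vert E^+(B, C\setminus B) \vert \geq \vert E^-(B, C\setminus B) \vert$, then the number of $\langle - \rangle$ edges with both end-vertices in $C$ is at most $3\cdot m_{\mathbb{H}}(\mathrm{OPT}(\mathbb{H}))$.
   Context: $\mathbb{H}$ is an undirected graph on vertex set $V$ whose edges are each labeled $\langle + \rangle$ or $\langle - \rangle$, together with a set $B\subseteq V$ of "bad" vertices; the vertices of $V\setminus B$ are "good". It is assumed that every two distinct good vertices are joined by an edge (labeled $\langle + \rangle$ or $\langle - \rangle$), every two distinct vertices of $B$ are joined by a $\langle + \rangle$ edge, and for every good vertex $v$ the edges between $v$ and $B$ are either all $\langle + \rangle$ or all $\langle - \rangle$ (there may be none). A clustering of $\mathbb{H}$ is a partition of $V$ in which all vertices of $B$ lie in the same part. Its number of mistakes $m_{\mathbb{H}}(\cdot)$ is the number of $\langle - \rangle$ edges inside parts plus the number of $\langle + \rangle$ edges between different parts; $\mathrm{OPT}(\mathbb{H})$ is a clustering of $\mathbb{H}$ minimizing this number. For a vertex $v$, $N^+(v)$ and $N^-(v)$ are the sets of vertices joined to $v$ by a $\langle + \rangle$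 resp. $\langle - \rangle$ edge. For $X\subseteq V$, $\overline{X}=V\setminus X$; for disjoint $X,Y$, $E^+(X,Y)$ (resp. $E^-(X,Y)$) is the set of $\langle + \rangle$ (resp. $\langle - \rangle$) edges with one end in $X$ and the other in $Y$. For $\delta>0$: a good vertex $v$ is $\delta$-good w.r.t. $C\subseteq V$ if $\vert N^-(v)\cap C\vert \le \delta\vert C\vert$ and $\vert N^+(v)\cap \overline{C}\vert\le \delta \vert C\vert$. For $C\supseteq B$, $B$ is $\delta$-good w.r.t. $C$ if $\vert E^-(B,C\setminus B)\vert \le \delta\vert B\vert\vert C\vert$ and $\vert E^+(B,\overline{C}\setminus B)\vert\le \delta\vert B\vert \vert C\vert$. A set $C\supseteq B$ is $\delta$-clean if every $v\in C\setminus B$ is $\delta$-good w.r.t. $C$ and $B$ is $\delta$-good w.r.t. $C$; a set $C$ with $C\cap B=\emptyset$ is $\delta$-clean if every $v\in C$ is $\delta$-good w.r.t. $C$.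
   Formalization: The parameter δ is rational. -}

module Defs where

open import Data.Nat using (ℕ; zero; suc; _+_; _*_; _≤_; _<_)
open import Data.Fin using (Fin)
open import Data.Fin.Properties using (_<?_)
open import Data.Bool using (Bool; true; false; _∧_; _∨_; not; if_then_else_)
open import Data.List using (List; map; allFin)
open import Data.Nat.ListAction using (sum)
open import Data.Product using (_×_)
open import Data.Sum using (_⊎_)
open import Relation.Binary.PropositionalEquality using (_≡_; _≢_)
open import Relation.Nullary.Decidable using (⌊_⌋)

data Label : Set where
  plus minus none : Label

isPlus : Label → Bool
isPlus plus = true
isPlus _    = false

isMinus : Label → Bool
isMinus minus = true
isMinus _     = false

count : ∀ {n} → (Fin n → Bool) → ℕ
count {n} P = sum (map (λ i → if P i then 1 else 0) (allFin n))

countOrd : ∀ {n} → (Fin n → Fin n → Bool) → ℕ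
countOrd {n} P = sum (map (λ u → count (P u)) (allFin n))

-- Number of unordered pairs {u , v}, u ≠ v, satisfying a predicate
-- (counted as the pairs with u < v).
countPairs : ∀ {n} → (Fin n → Fin n → Bool) → ℕ
countPairs P = countOrd (λ u v → ⌊ u <? v ⌋ ∧ P u v)

-- The structure ℍ : vertex set Fin n, labelling lab (lab u v = label of
-- the edge {u,v}, or none), bad set B (as a Boolean predicate).
record IsH {n : ℕ} (lab : Fin n → Fin n → Label) (B : Fin n → Bool) : Set where
  field
    symm      : ∀ u v → lab u v ≡ lab v u
    irrefl    : ∀ v → lab v v ≡ none
    goodGood  : ∀ u v → B u ≡ false → B v ≡ false → u ≢ v → lab u v ≢ none
    badBad    : ∀ u v → B u ≡ true → B v ≡ true → u ≢ v → lab u v ≡ plus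
    goodToBad : ∀ v → B v ≡ false →
                  (∀ b → B b ≡ true → lab v b ≢ minus)
                ⊎ (∀ b → B b ≡ true → lab v b ≢ plus)

-- A clustering: cluster index per vertex, all bad vertices in one part.
IsClustering : ∀ {n} → (Fin n → Bool) → (Fin n → Fin n) → Set
IsClustering B cl = ∀ b b′ → B b ≡ true → B b′ ≡ true → cl b ≡ cl b′

mistakes : ∀ {n} → (Fin n → Fin n → Label) → (Fin n → Fin n) → ℕ
mistakes lab cl = countPairs (λ u v →
    (isMinus (lab u v) ∧ ⌊ cl u Data.Fin.≟ cl v ⌋)
  ∨ (isPlus (lab u v) ∧ not ⌊ cl u Data.Fin.≟ cl v ⌋))

-- δ = p / q with q > 0.
-- Good vertex v is δ-good w.r.t. C.
VertexGood : ∀ {n} → (Fin n → Fin n → Label) → (p q : ℕ) → (Fin n → Bool) → Fin n → Set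
VertexGood lab p q C v =
    q * count (λ u → isMinus (lab v u) ∧ C u) ≤ p * count C
  × q * count (λ u → isPlus (lab v u) ∧ not (C u)) ≤ p * count C

Eminus : ∀ {n} → (Fin n → Fin n → Label) → (X Y : Fin n → Bool) → ℕ
Eminus lab X Y = countOrd (λ u v → X u ∧ Y v ∧ isMinus (lab u v))

Eplus : ∀ {n} → (Fin n → Fin n → Label) → (X Y : Fin n → Bool) → ℕ
Eplus lab X Y = countOrd (λ u v → X u ∧ Y v ∧ isPlus (lab u v))

BadGood : ∀ {n} → (Fin n → Fin n → Label) → (B : Fin n → Bool) → (p q : ℕ) → (Fin n → Bool) → Set
BadGood lab B p q C =
    q * Eminus lab B (λ u → C u ∧ not (B u)) ≤ p * count B * count C
  × q * Eplus lab B (λ u → not (C u) ∧ not (B u)) ≤ p * count B * count C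

CleanWithB : ∀ {n} → (Fin n → Fin n → Label) → (B : Fin n → Bool) → (p q : ℕ) → (Fin n → Bool) → Set
CleanWithB lab B p q C =
    (∀ v → C v ≡ true → B v ≡ false → VertexGood lab p q C v)
  × BadGood lab B p q C

module Submission where

-- Let G = C ∖ B and δ = p / q. Since |C| > |B| / δ and δ ≤ 1/5, |G| ≥ 4δ|C|, while by cleanness
-- every vertex of G has at most δ|C| ⟨-⟩ neighbours in C. Fix a clustering. A vertex of G in a
-- different cluster than v ∈ G is joined to v by a ⟨-⟩ edge or by a "cut" ⟨+⟩ edge (a ⟨+⟩
-- mistake inside G). Every vertex of G is apart from one of two apart vertices u, v ∈ G, so u and
-- v together have at least 2δ|C| cut ⟨+⟩ edges; as each vertex lies on at most δ|C| ⟨-⟩ edges,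
-- double counting bounds the ⟨-⟩ edges of G between clusters by the cut ⟨+⟩ edges. Hence the
-- ⟨-⟩ edges inside G cost at most the mistakes inside G, which gives the first bound even with
-- constant 1.
-- For the ⟨-⟩ edges between B and G, let K be the cluster of B. Either K or its complement
-- contains at least 2δ|C| vertices of G, and every vertex of G on the other side then has at
-- least as many cut ⟨+⟩ edges as there are bad vertices. So in the first case the ⟨-⟩ edges from B leaving
-- K, and in the second (using |E⁻(B, G)| ≤ |E⁺(B, G)|) the ⟨+⟩ edges from B into K, are paid for
-- by cut edges; the remaining edges between B and G are mistakes.

open import Defs
open import Data.Nat using (ℕ; _+_; _*_; _≤_; _<_; z≤n; >-nonZero)
open import Data.Nat.Properties hiding (_<?_; <-cmp; <-asym; _≟_)
open import Data.Nat.ListAction using (sum)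
open import Data.Nat.Tactic.RingSolver using (solve-∀)
open import Data.Bool using (Bool; true; false; _∧_; _∨_; not; if_then_else_) renaming (_≟_ to _≟ᵇ_)
open import Data.Bool.Properties using (not-injective; ¬-not; ∧-zeroʳ)
open import Data.Bool.Solver using (module ∨-∧-Solver)
open import Data.Fin using (Fin; _≟_) renaming (_<_ to _<ᶠ_)
open import Data.Fin.Properties using (_<?_; <-cmp; <-asym; any?)
open import Data.List using (List; []; _∷_; map; allFin)
open import Data.Product using (_×_; _,_; proj₁; proj₂)
open import Data.Sum using (_⊎_; inj₁; inj₂; [_,_])
open import Function using (_∘_)
open import Relation.Binary.Definitions using (tri<; tri≈; tri>)
open import Relation.Binary.PropositionalEquality
  using (_≡_; _≢_; refl; sym; trans; cong; cong₂; module ≡-Reasoning)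
open import Relation.Nullary using (yes; no; contradiction)
open import Relation.Nullary.Decidable using (⌊_⌋)

open ∨-∧-Solver using (solve; _:=_; _:*_)

module _ {A : Set} where

  sum-map-mono : ∀ (xs : List A) {f g : A → ℕ} → (∀ x → f x ≤ g x) →
                 sum (map f xs) ≤ sum (map g xs)
  sum-map-mono []       h = z≤n
  sum-map-mono (x ∷ xs) h = +-mono-≤ (h x) (sum-map-mono xs h)

  sum-map-cong : ∀ (xs : List A) {f g : A → ℕ} → (∀ x → f x ≡ g x) →
                 sum (map f xs) ≡ sum (map g xs)
  sum-map-cong []       h = refl
  sum-map-cong (x ∷ xs) h = cong₂ _+_ (h x) (sum-map-cong xs h)

  sum-map-zero : ∀ (xs : List A) → sum (map (λ _ → 0) xs) ≡ 0
  sum-map-zero []       = refl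
  sum-map-zero (x ∷ xs) = sum-map-zero xs

  sum-map-+ : ∀ (xs : List A) (f g : A → ℕ) →
              sum (map (λ x → f x + g x) xs) ≡ sum (map f xs) + sum (map g xs)
  sum-map-+ []       f g = refl
  sum-map-+ (x ∷ xs) f g = begin
    f x + g x + sum (map (λ x → f x + g x) xs)    ≡⟨ cong (f x + g x +_) (sum-map-+ xs f g) ⟩
    f x + g x + (sum (map f xs) + sum (map g xs)) ≡⟨ +-+-swap (f x) (g x) _ _ ⟩
    f x + sum (map f xs) + (g x + sum (map g xs)) ∎
    where
    open ≡-Reasoning
    +-+-swap : ∀ a b c d → a + b + (c + d) ≡ a + c + (b + d)
    +-+-swap = solve-∀

  sum-map-*ˡ : ∀ (xs : List A) (c : ℕ) (f : A → ℕ) →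
               sum (map (λ x → c * f x) xs) ≡ c * sum (map f xs)
  sum-map-*ˡ []       c f = sym (*-zeroʳ c)
  sum-map-*ˡ (x ∷ xs) c f =
    trans (cong (c * f x +_) (sum-map-*ˡ xs c f)) (sym (*-distribˡ-+ c (f x) _))

sum-map-swap : ∀ {A B : Set} (xs : List A) (ys : List B) (h : A → B → ℕ) →
               sum (map (λ a → sum (map (h a) ys)) xs) ≡
               sum (map (λ b → sum (map (λ a → h a b) xs)) ys)
sum-map-swap []       ys h = sym (sum-map-zero ys)
sum-map-swap (x ∷ xs) ys h =
  trans (cong (sum (map (h x) ys) +_) (sum-map-swap xs ys h))
        (sym (sum-map-+ ys (h x) (λ b → sum (map (λ a → h a b) xs))))

∑ : ∀ {n} → (Fin n → ℕ) → ℕ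
∑ {n} f = sum (map f (allFin n))

module _ {n : ℕ} where

  ∑-mono : {f g : Fin n → ℕ} → (∀ i → f i ≤ g i) → ∑ f ≤ ∑ g
  ∑-mono = sum-map-mono (allFin n)

  ∑-cong : {f g : Fin n → ℕ} → (∀ i → f i ≡ g i) → ∑ f ≡ ∑ g
  ∑-cong = sum-map-cong (allFin n)

  ∑-+ : (f g : Fin n → ℕ) → ∑ (λ i → f i + g i) ≡ ∑ f + ∑ g
  ∑-+ = sum-map-+ (allFin n)

  ∑-*ˡ : (c : ℕ) (f : Fin n → ℕ) → ∑ (λ i → c * f i) ≡ c * ∑ f
  ∑-*ˡ = sum-map-*ˡ (allFin n)

  ∑-swap : (h : Fin n → Fin n → ℕ) → ∑ (λ i → ∑ (h i)) ≡ ∑ (λ j → ∑ (λ i → h i j))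
  ∑-swap = sum-map-swap (allFin n) (allFin n)

∧-elim : ∀ a {b} → a ∧ b ≡ true → a ≡ true × b ≡ true
∧-elim true e = refl , e

∧₃-elim : ∀ a b {c} → a ∧ b ∧ c ≡ true → a ≡ true × b ≡ true × c ≡ true
∧₃-elim true true e = refl , refl , e

∧-intro : ∀ {a b} → a ≡ true → b ≡ true → a ∧ b ≡ true
∧-intro refl e = e

∨-elim : ∀ a {b} → a ∨ b ≡ true → a ≡ true ⊎ b ≡ true
∨-elim true  _ = inj₁ refl
∨-elim false e = inj₂ e

∨-introˡ : ∀ {a b} → a ≡ true → a ∨ b ≡ true
∨-introˡ refl = refl

∨-introʳ : ∀ a {b} → b ≡ true → a ∨ b ≡ true
∨-introʳ true  _ = refl
∨-introʳ false e = e

bool-cases : ∀ b → b ≡ true ⊎ b ≡ false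
bool-cases true  = inj₁ refl
bool-cases false = inj₂ refl

isMinus⇒≡minus : ∀ {l} → isMinus l ≡ true → l ≡ minus
isMinus⇒≡minus {minus} _ = refl

isPlus⇒≡plus : ∀ {l} → isPlus l ≡ true → l ≡ plus
isPlus⇒≡plus {plus} _ = refl

ind : Bool → ℕ
ind b = if b then 1 else 0

ind-mono : ∀ {a b} → (a ≡ true → b ≡ true) → ind a ≤ ind b
ind-mono {false} h = z≤n
ind-mono {true}  h rewrite h refl = ≤-refl

ind-∨ : ∀ a b → ind (a ∨ b) ≤ ind a + ind b
ind-∨ false b = ≤-refl
ind-∨ true  b = m≤m+n 1 (ind b)

ind-∨-disjoint : ∀ {a b} → (a ≡ true → b ≡ false) → ind (a ∨ b) ≡ ind a + ind b
ind-∨-disjoint {false} h = refl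
ind-∨-disjoint {true}  h rewrite h refl = refl

ind-split : ∀ a b → ind a ≡ ind (a ∧ b) + ind (a ∧ not b)
ind-split false b     = refl
ind-split true  false = refl
ind-split true  true  = refl

module _ {n : ℕ} {P Q : Fin n → Bool} where

  count-mono : (∀ i → P i ≡ true → Q i ≡ true) → count P ≤ count Q
  count-mono h = ∑-mono (λ i → ind-mono (h i))

  count-cong : (∀ i → P i ≡ Q i) → count P ≡ count Q
  count-cong h = ∑-cong (λ i → cong ind (h i))

  count-∨-disjoint : (∀ i → P i ≡ true → Q i ≡ false) →
                     count (λ i → P i ∨ Q i) ≡ count P + count Q
  count-∨-disjoint h = trans (∑-cong (λ i → ind-∨-disjoint (h i))) (∑-+ (ind ∘ P) (ind ∘ Q))

module _ {n : ℕ} (P Q : Fin n → Bool) where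

  count-∨ : count (λ i → P i ∨ Q i) ≤ count P + count Q
  count-∨ = ≤-trans (∑-mono (λ i → ind-∨ (P i) (Q i))) (≤-reflexive (∑-+ (ind ∘ P) (ind ∘ Q)))

  count-split : count P ≡ count (λ i → P i ∧ Q i) + count (λ i → P i ∧ not (Q i))
  count-split = trans (∑-cong (λ i → ind-split (P i) (Q i)))
                      (∑-+ (λ i → ind (P i ∧ Q i)) (λ i → ind (P i ∧ not (Q i))))

count-none : ∀ {n} {P : Fin n → Bool} → (∀ i → P i ≡ false) → count P ≡ 0
count-none {n} h = trans (∑-cong (λ i → cong ind (h i))) (sum-map-zero (allFin n))

module _ {n : ℕ} {P Q : Fin n → Fin n → Bool} where

  countOrd-mono : (∀ u v → P u v ≡ true → Q u v ≡ true) → countOrd P ≤ countOrd Q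
  countOrd-mono h = ∑-mono (λ u → count-mono (h u))

  countOrd-cong : (∀ u v → P u v ≡ Q u v) → countOrd P ≡ countOrd Q
  countOrd-cong h = ∑-cong (λ u → count-cong (h u))

  countOrd-∨-disjoint : (∀ u v → P u v ≡ true → Q u v ≡ false) →
                        countOrd (λ u v → P u v ∨ Q u v) ≡ countOrd P + countOrd Q
  countOrd-∨-disjoint h =
    trans (∑-cong (λ u → count-∨-disjoint (h u))) (∑-+ (count ∘ P) (count ∘ Q))

module _ {n : ℕ} (P Q : Fin n → Fin n → Bool) where

  countOrd-∨ : countOrd (λ u v → P u v ∨ Q u v) ≤ countOrd P + countOrd Q
  countOrd-∨ =
    ≤-trans (∑-mono (λ u → count-∨ (P u) (Q u))) (≤-reflexive (∑-+ (count ∘ P) (count ∘ Q)))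

  countOrd-split :
    countOrd P ≡ countOrd (λ u v → P u v ∧ Q u v) + countOrd (λ u v → P u v ∧ not (Q u v))
  countOrd-split = trans (∑-cong (λ u → count-split (P u) (Q u)))
    (∑-+ (λ u → count (λ v → P u v ∧ Q u v)) (λ u → count (λ v → P u v ∧ not (Q u v))))

countOrd-transpose : ∀ {n} (P : Fin n → Fin n → Bool) → countOrd P ≡ countOrd (λ u v → P v u)
countOrd-transpose P = ∑-swap (λ u v → ind (P u v))

module _ {n : ℕ} (R : Fin n → Fin n → Bool) (R-sym : ∀ u v → R u v ≡ R v u) where

  private
    _<ᵇ_ : Fin n → Fin n → Bool
    u <ᵇ v = ⌊ u <? v ⌋

    eitherOrder : Fin n → Fin n → Bool
    eitherOrder u v = (u <ᵇ v ∧ R u v) ∨ (v <ᵇ u ∧ R u v)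

    <ᵇ-intro : ∀ {u v} → u <ᶠ v → u <ᵇ v ≡ true
    <ᵇ-intro {u} {v} u<v with u <? v
    ... | yes _   = refl
    ... | no u≮v = contradiction u<v u≮v

    <ᵇ-asym : ∀ {u v} → u <ᵇ v ≡ true → v <ᵇ u ≡ false
    <ᵇ-asym {u} {v} u<v with u <? v | v <? u
    ... | yes u<v | yes v<u = contradiction v<u (<-asym u<v)
    ... | _       | no _    = refl

    2*countPairs≡countOrd-eitherOrder : 2 * countPairs R ≡ countOrd eitherOrder
    2*countPairs≡countOrd-eitherOrder = begin
      countPairs R + (countPairs R + 0)
        ≡⟨ cong (countPairs R +_) (+-identityʳ _) ⟩
      countPairs R + countPairs R
        ≡⟨ cong (countPairs R +_) (countOrd-transpose (λ u v → u <ᵇ v ∧ R u v)) ⟩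
      countPairs R + countOrd (λ u v → v <ᵇ u ∧ R v u)
        ≡⟨ cong (countPairs R +_) (countOrd-cong (λ u v → cong (v <ᵇ u ∧_) (R-sym v u))) ⟩
      countPairs R + countOrd (λ u v → v <ᵇ u ∧ R u v)
        ≡⟨ countOrd-∨-disjoint disjoint ⟨
      countOrd eitherOrder ∎
      where
      open ≡-Reasoning
      disjoint : ∀ u v → u <ᵇ v ∧ R u v ≡ true → v <ᵇ u ∧ R u v ≡ false
      disjoint u v e rewrite <ᵇ-asym {u} {v} (proj₁ (∧-elim (u <ᵇ v) e)) = refl

  2*countPairs≤countOrd : 2 * countPairs R ≤ countOrd R
  2*countPairs≤countOrd = ≤-trans (≤-reflexive 2*countPairs≡countOrd-eitherOrder) (countOrd-mono below)
    where
    below : ∀ u v → eitherOrder u v ≡ true → R u v ≡ true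
    below u v e with ∨-elim (u <ᵇ v ∧ R u v) e
    ... | inj₁ e′ = proj₂ (∧-elim (u <ᵇ v) e′)
    ... | inj₂ e′ = proj₂ (∧-elim (v <ᵇ u) e′)

  countOrd≤2*countPairs : (∀ u → R u u ≡ false) → countOrd R ≤ 2 * countPairs R
  countOrd≤2*countPairs R-irrefl =
    ≤-trans (countOrd-mono above) (≤-reflexive (sym 2*countPairs≡countOrd-eitherOrder))
    where
    above : ∀ u v → R u v ≡ true → eitherOrder u v ≡ true
    above u v e with <-cmp u v
    ... | tri< u<v _ _  = ∨-introˡ (∧-intro (<ᵇ-intro {u} {v} u<v) e)
    ... | tri≈ _ refl _ = contradiction (trans (sym e) (R-irrefl u)) λ ()
    ... | tri> _ _ v<u  = ∨-introʳ (u <ᵇ v ∧ R u v) (∧-intro (<ᵇ-intro {v} {u} v<u) e)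

-- Double counting: 2X·|D| ≤ Σ_{D u v} q (f u + f v) = 2 Σ_u q |D u| f u ≤ 2X Σ f.
countOrd≤∑-sparse-heavy : ∀ {n} (D : Fin n → Fin n → Bool) (f : Fin n → ℕ) {q X : ℕ} → 0 < X →
  (∀ u v → D u v ≡ D v u) → (∀ u → q * count (D u) ≤ X) →
  (∀ u v → D u v ≡ true → 2 * X ≤ q * (f u + f v)) → countOrd D ≤ ∑ f
countOrd≤∑-sparse-heavy {n} D f {q} {X} X>0 D-sym sparse heavy =
  *-cancelˡ-≤ (2 * X) {{>-nonZero (*-monoʳ-< 2 X>0)}} (begin
    2 * X * countOrd D
      ≡⟨ ∑-*ˡ (2 * X) (count ∘ D) ⟨
    ∑ (λ u → 2 * X * count (D u))
      ≡⟨ ∑-cong (λ u → ∑-*ˡ (2 * X) (ind ∘ D u)) ⟨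
    ∑ (λ u → ∑ (λ v → 2 * X * ind (D u v)))
      ≤⟨ ∑-mono (λ u → ∑-mono (λ v → pointwise u v)) ⟩
    ∑ (λ u → ∑ (λ v → t u v + t v u))
      ≡⟨ ∑-cong (λ u → ∑-+ (t u) (λ v → t v u)) ⟩
    ∑ (λ u → ∑ (t u) + ∑ (λ v → t v u))
      ≡⟨ ∑-+ (λ u → ∑ (t u)) (λ u → ∑ (λ v → t v u)) ⟩
    T + ∑ (λ u → ∑ (λ v → t v u))
      ≡⟨ cong (T +_) (∑-swap t) ⟨
    T + T
      ≤⟨ +-mono-≤ T≤X∑f T≤X∑f ⟩
    X * ∑ f + X * ∑ f
      ≡⟨ x*y+x*y≡2*x*y X (∑ f) ⟩
    2 * X * ∑ f ∎)
  where
  open ≤-Reasoning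
  t : Fin n → Fin n → ℕ
  t u v = q * f u * ind (D u v)

  T : ℕ
  T = ∑ (λ u → ∑ (t u))

  x*y+x*y≡2*x*y : ∀ x y → x * y + x * y ≡ 2 * x * y
  x*y+x*y≡2*x*y = solve-∀

  pointwise : ∀ u v → 2 * X * ind (D u v) ≤ t u v + t v u
  pointwise u v with D u v in e
  ... | false rewrite *-zeroʳ (2 * X) = z≤n
  ... | true rewrite sym (D-sym u v) | e
                   | *-identityʳ (2 * X) | *-identityʳ (q * f u) | *-identityʳ (q * f v) =
    ≤-trans (heavy u v e) (≤-reflexive (*-distribˡ-+ q (f u) (f v)))

  T≤X∑f : T ≤ X * ∑ f
  T≤X∑f = begin
    ∑ (λ u → ∑ (t u))                 ≡⟨ ∑-cong (λ u → ∑-*ˡ (q * f u) (ind ∘ D u)) ⟩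
    ∑ (λ u → q * f u * count (D u))   ≡⟨ ∑-cong (λ u → rearrange q (f u) (count (D u))) ⟩
    ∑ (λ u → q * count (D u) * f u)   ≤⟨ ∑-mono (λ u → *-monoˡ-≤ (f u) (sparse u)) ⟩
    ∑ (λ u → X * f u)                 ≡⟨ ∑-*ˡ X f ⟩
    X * ∑ f                           ∎
    where
    rearrange : ∀ a b c → a * b * c ≡ a * c * b
    rearrange = solve-∀

m+m≤n+o⇒m≤n⊎m≤o : ∀ a b c → a + a ≤ b + c → a ≤ b ⊎ a ≤ c
m+m≤n+o⇒m≤n⊎m≤o a b c le with a ≤? b | a ≤? c
... | yes a≤b | _       = inj₁ a≤b
... | no _    | yes a≤c = inj₂ a≤c
... | no a≰b  | no a≰c  = contradiction le (<⇒≱ (+-mono-< (≰⇒> a≰b) (≰⇒> a≰c)))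

2*m+2*m≡4*m : ∀ m → 2 * m + 2 * m ≡ 4 * m
2*m+2*m≡4*m = solve-∀

module CleanCluster {n : ℕ} (lab : Fin n → Fin n → Label) (B : Fin n → Bool) (H : IsH lab B)
  (p q : ℕ) (C : Fin n → Bool) (cl : Fin n → Fin n) where

  open IsH H

  -- With δ = p / q, the inequality x ≤ δ|C| is encoded as q * x ≤ δ∣C∣.
  δ∣C∣ : ℕ
  δ∣C∣ = p * count C

  C∖B : Fin n → Bool
  C∖B v = C v ∧ not (B v)

  C∖B-elim : ∀ {v} → C∖B v ≡ true → C v ≡ true × B v ≡ false
  C∖B-elim {v} e = let (c , nb) = ∧-elim (C v) e in c , not-injective nb

  together : Fin n → Fin n → Bool
  together u v = ⌊ cl u ≟ cl v ⌋

  together⇒≡ : ∀ {u v} → together u v ≡ true → cl u ≡ cl v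
  together⇒≡ {u} {v} e with cl u ≟ cl v
  ... | yes eq = eq

  together-intro : ∀ {u v} → cl u ≡ cl v → together u v ≡ true
  together-intro {u} {v} eq with cl u ≟ cl v
  ... | yes _   = refl
  ... | no neq = contradiction eq neq

  apart⇒≢ : ∀ {u v} → together u v ≡ false → cl u ≢ cl v
  apart⇒≢ apart eq = contradiction (trans (sym apart) (together-intro eq)) λ ()

  apart-intro : ∀ {u v} → cl u ≢ cl v → together u v ≡ false
  apart-intro {u} {v} neq with cl u ≟ cl v
  ... | yes eq = contradiction eq neq
  ... | no _   = refl

  together-sym : ∀ u v → together u v ≡ together v u
  together-sym u v with cl u ≟ cl v | cl v ≟ cl u
  ... | yes _  | yes _  = refl
  ... | no _   | no _   = refl
  ... | yes eq | no neq = contradiction (sym eq) neq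
  ... | no neq | yes eq = contradiction (sym eq) neq

  mistake : Fin n → Fin n → Bool
  mistake u v = (isMinus (lab u v) ∧ together u v) ∨ (isPlus (lab u v) ∧ not (together u v))

  mistake-sym : ∀ u v → mistake u v ≡ mistake v u
  mistake-sym u v rewrite symm u v | together-sym u v = refl

  mistake-irrefl : ∀ u → mistake u u ≡ false
  mistake-irrefl u rewrite irrefl u = refl

  cutPlus : Fin n → Fin n → Bool
  cutPlus u w = C∖B u ∧ C∖B w ∧ isPlus (lab u w) ∧ not (together u w)

  cutDeg : Fin n → ℕ
  cutDeg u = count (cutPlus u)

  minusNbrC : Fin n → Fin n → Bool
  minusNbrC u w = isMinus (lab u w) ∧ C w

  apartFrom : Fin n → Fin n → Bool
  apartFrom v w = C∖B w ∧ not (together v w)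

  apart⇒cutPlus∨minusNbrC : ∀ {v w} → C∖B v ≡ true → C∖B w ≡ true → together v w ≡ false →
                            (cutPlus v w ∨ minusNbrC v w) ≡ true
  apart⇒cutPlus∨minusNbrC {v} {w} gv gw apart with lab v w in e
  ... | plus  rewrite gv | gw | apart = refl
  ... | minus rewrite gv | gw = proj₁ (C∖B-elim gw)
  ... | none  = contradiction e (goodGood v w (proj₂ (C∖B-elim gv)) (proj₂ (C∖B-elim gw)) v≢w)
    where
    v≢w : v ≢ w
    v≢w refl = apart⇒≢ apart refl

  mistakesC∖B² mistakesB×C∖B : ℕ
  mistakesC∖B² = countOrd (λ u v → C∖B u ∧ C∖B v ∧ mistake u v)
  mistakesB×C∖B = countOrd (λ b v → B b ∧ C∖B v ∧ mistake b v)

  ordered-mistakes : mistakesC∖B² + 2 * mistakesB×C∖B ≤ 2 * mistakes lab cl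
  ordered-mistakes = begin
    GG + (BG + (BG + 0))                        ≡⟨ cong (λ x → GG + (BG + x)) BG≡GB ⟩
    GG + (BG + countOrd gb)                     ≡⟨ cong (GG +_) (countOrd-∨-disjoint bg∩gb) ⟨
    GG + countOrd (λ u v → bg u v ∨ gb u v)     ≡⟨ countOrd-∨-disjoint gg∩[bg∪gb] ⟨
    countOrd (λ u v → gg u v ∨ bg u v ∨ gb u v) ≤⟨ countOrd-mono ⊆mistake ⟩
    countOrd mistake                            ≤⟨ countOrd≤2*countPairs mistake mistake-sym mistake-irrefl ⟩
    2 * mistakes lab cl                         ∎
    where
    open ≤-Reasoning
    gg bg gb : Fin n → Fin n → Bool
    gg u v = C∖B u ∧ C∖B v ∧ mistake u v
    bg u v = B u ∧ C∖B v ∧ mistake u v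
    gb u v = C∖B u ∧ B v ∧ mistake u v
    GG BG : ℕ
    GG = countOrd gg
    BG = countOrd bg
    BG≡GB : BG + 0 ≡ countOrd gb
    BG≡GB = trans (+-identityʳ BG) (trans (countOrd-transpose bg) (countOrd-cong swap))
      where
      swap : ∀ u v → bg v u ≡ gb u v
      swap u v rewrite mistake-sym v u =
        solve 3 (λ a b c → a :* (b :* c) := b :* (a :* c)) refl (B v) (C∖B u) (mistake u v)
    bg∩gb : ∀ u v → bg u v ≡ true → gb u v ≡ false
    bg∩gb u v e rewrite proj₁ (∧-elim (B u) e) | ∧-zeroʳ (C u) = refl
    gg∩[bg∪gb] : ∀ u v → gg u v ≡ true → (bg u v ∨ gb u v) ≡ false
    gg∩[bg∪gb] u v e with ∧₃-elim (C∖B u) (C∖B v) e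
    ... | gu , gv , _ rewrite gu | proj₂ (C∖B-elim gu) | proj₂ (C∖B-elim gv) = refl
    ⊆mistake : ∀ u v → (gg u v ∨ bg u v ∨ gb u v) ≡ true → mistake u v ≡ true
    ⊆mistake u v e with ∨-elim (gg u v) e
    ... | inj₁ e₁ = proj₂ (proj₂ (∧₃-elim (C∖B u) (C∖B v) e₁))
    ... | inj₂ e₁ with ∨-elim (bg u v) e₁
    ... | inj₁ e₂ = proj₂ (proj₂ (∧₃-elim (B u) (C∖B v) e₂))
    ... | inj₂ e₂ = proj₂ (proj₂ (∧₃-elim (C∖B u) (B v) e₂))

  cutPlus⇒mistake : ∀ u v → cutPlus u v ≡ true → (C∖B u ∧ C∖B v ∧ mistake u v) ≡ true
  cutPlus⇒mistake u v e =
    let (gu , gv , e₁) = ∧₃-elim (C∖B u) (C∖B v) e ; (isplus , apart) = ∧-elim (isPlus (lab u v)) e₁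
    in ∧-intro gu (∧-intro gv (∨-introʳ (isMinus (lab u v) ∧ together u v) (∧-intro isplus apart)))

  minusC∖B : Fin n → Fin n → Bool
  minusC∖B u v = C u ∧ not (B u) ∧ C v ∧ not (B v) ∧ isMinus (lab u v)

  minusC∖B-elim : ∀ {u v} → minusC∖B u v ≡ true →
                  C∖B u ≡ true × C∖B v ≡ true × isMinus (lab u v) ≡ true
  minusC∖B-elim {u} {v} e =
    let (cu , nbu , e₁) = ∧₃-elim (C u) (not (B u)) e ; (cv , nbv , m) = ∧₃-elim (C v) (not (B v)) e₁
    in ∧-intro cu nbu , ∧-intro cv nbv , m

  minusC∖B-sym : ∀ u v → minusC∖B u v ≡ minusC∖B v u
  minusC∖B-sym u v rewrite symm u v =
    solve 5 (λ a b c d e → a :* (b :* (c :* (d :* e))) := c :* (d :* (a :* (b :* e)))) refl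
      (C u) (not (B u)) (C v) (not (B v)) (isMinus (lab v u))

  separatedMinus : Fin n → Fin n → Bool
  separatedMinus u v = minusC∖B u v ∧ not (together u v)

  crossMinus crossPlus : Fin n → Fin n → Bool
  crossMinus b v = B b ∧ C∖B v ∧ isMinus (lab b v)
  crossPlus  b v = B b ∧ C∖B v ∧ isPlus (lab b v)

  minusC : Fin n → Fin n → Bool
  minusC u v = C u ∧ C v ∧ isMinus (lab u v)

  minusC-sym : ∀ u v → minusC u v ≡ minusC v u
  minusC-sym u v rewrite symm u v =
    solve 3 (λ a b c → a :* (b :* c) := b :* (a :* c)) refl (C u) (C v) (isMinus (lab v u))

  minusC-cover : ∀ u v → minusC u v ≡ true →
                 (minusC∖B u v ∨ crossMinus u v ∨ crossMinus v u) ≡ true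
  minusC-cover u v e with ∧₃-elim (C u) (C v) e | bool-cases (B u) | bool-cases (B v)
  ... | cu , cv , m | inj₂ bu | inj₂ bv =
    ∨-introˡ (∧-intro cu (∧-intro (cong not bu) (∧-intro cv (∧-intro (cong not bv) m))))
  ... | cu , cv , m | inj₁ bu | inj₂ bv =
    ∨-introʳ (minusC∖B u v) (∨-introˡ (∧-intro bu (∧-intro (∧-intro cv (cong not bv)) m)))
  ... | cu , cv , m | inj₂ bu | inj₁ bv =
    ∨-introʳ (minusC∖B u v) (∨-introʳ (crossMinus u v)
      (∧-intro bv (∧-intro (∧-intro cu (cong not bu)) (trans (cong isMinus (symm v u)) m))))
  ... | _ , _ , m | inj₁ bu | inj₁ bv with u ≟ v
  ...   | yes refl = contradiction (trans (sym m) (cong isMinus (irrefl u))) λ ()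
  ...   | no u≢v   = contradiction (trans (sym m) (cong isMinus (badBad u v bu bv u≢v))) λ ()

  module _ (5p≤q : 5 * p ≤ q) (B-small : q * count B < δ∣C∣)
           (clean : ∀ v → C v ≡ true → B v ≡ false → VertexGood lab p q C v) where

    C∖B-large : 4 * δ∣C∣ ≤ q * count C∖B
    C∖B-large = +-cancelʳ-≤ δ∣C∣ (4 * δ∣C∣) (q * count C∖B) (begin
      4 * δ∣C∣ + δ∣C∣             ≡⟨ 4*m+m≡5*m δ∣C∣ ⟩
      5 * (p * count C)           ≡⟨ *-assoc 5 p (count C) ⟨
      5 * p * count C             ≤⟨ *-monoˡ-≤ (count C) 5p≤q ⟩
      q * count C                 ≤⟨ *-monoʳ-≤ q (≤-trans (count-mono C⊆C∖B∪B) (count-∨ C∖B B)) ⟩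
      q * (count C∖B + count B)   ≡⟨ *-distribˡ-+ q (count C∖B) (count B) ⟩
      q * count C∖B + q * count B ≤⟨ +-monoʳ-≤ (q * count C∖B) (<⇒≤ B-small) ⟩
      q * count C∖B + δ∣C∣        ∎)
      where
      open ≤-Reasoning
      4*m+m≡5*m : ∀ m → 4 * m + m ≡ 5 * m
      4*m+m≡5*m = solve-∀
      C⊆C∖B∪B : ∀ w → C w ≡ true → (C∖B w ∨ B w) ≡ true
      C⊆C∖B∪B w c rewrite c with B w
      ... | true  = refl
      ... | false = refl

    apartFrom-bound : ∀ {v} → C∖B v ≡ true → q * count (apartFrom v) ≤ q * cutDeg v + δ∣C∣
    apartFrom-bound {v} gv = begin
      q * count (apartFrom v)                ≤⟨ *-monoʳ-≤ q apart≤ ⟩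
      q * (cutDeg v + count (minusNbrC v))   ≡⟨ *-distribˡ-+ q (cutDeg v) (count (minusNbrC v)) ⟩
      q * cutDeg v + q * count (minusNbrC v) ≤⟨ +-monoʳ-≤ (q * cutDeg v) clean-v ⟩
      q * cutDeg v + δ∣C∣                    ∎
      where
      open ≤-Reasoning
      clean-v : q * count (minusNbrC v) ≤ δ∣C∣
      clean-v = proj₁ (clean v (proj₁ (C∖B-elim gv)) (proj₂ (C∖B-elim gv)))
      disagrees : ∀ w → apartFrom v w ≡ true → (cutPlus v w ∨ minusNbrC v w) ≡ true
      disagrees w e = let (gw , apart) = ∧-elim (C∖B w) e in
        apart⇒cutPlus∨minusNbrC gv gw (not-injective apart)
      apart≤ : count (apartFrom v) ≤ cutDeg v + count (minusNbrC v)
      apart≤ = ≤-trans (count-mono disagrees) (count-∨ (cutPlus v) (minusNbrC v))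

    -- Every vertex of C∖B is apart from u or from v, and is then a cut ⟨+⟩ or a ⟨-⟩ neighbour of it.
    apart-pair-heavy : ∀ {u v} → C∖B u ≡ true → C∖B v ≡ true → together u v ≡ false →
                       2 * δ∣C∣ ≤ q * (cutDeg u + cutDeg v)
    apart-pair-heavy {u} {v} gu gv apart = +-cancelʳ-≤ (2 * δ∣C∣) (2 * δ∣C∣) _ (begin
      2 * δ∣C∣ + 2 * δ∣C∣                               ≡⟨ 2*m+2*m≡4*m δ∣C∣ ⟩
      4 * δ∣C∣                                          ≤⟨ C∖B-large ⟩
      q * count C∖B                                     ≤⟨ *-monoʳ-≤ q C∖B≤apart ⟩
      q * (count (apartFrom u) + count (apartFrom v))   ≡⟨ *-distribˡ-+ q (count (apartFrom u)) _ ⟩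
      q * count (apartFrom u) + q * count (apartFrom v) ≤⟨ +-mono-≤ (apartFrom-bound gu)
                                                                     (apartFrom-bound gv) ⟩
      q * cutDeg u + δ∣C∣ + (q * cutDeg v + δ∣C∣)       ≡⟨ collect q (cutDeg u) (cutDeg v) δ∣C∣ ⟩
      q * (cutDeg u + cutDeg v) + 2 * δ∣C∣              ∎)
      where
      open ≤-Reasoning
      collect : ∀ q a b x → q * a + x + (q * b + x) ≡ q * (a + b) + 2 * x
      collect = solve-∀
      apart-from-one : ∀ w → C∖B w ≡ true → (apartFrom u w ∨ apartFrom v w) ≡ true
      apart-from-one w gw with bool-cases (together u w)
      ... | inj₂ uw = ∨-introˡ (∧-intro gw (cong not uw))
      ... | inj₁ uw = ∨-introʳ (apartFrom u w) (∧-intro gw (cong not vw))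
        where
        vw : together v w ≡ false
        vw = apart-intro λ eq → apart⇒≢ apart (trans (together⇒≡ uw) (sym eq))
      C∖B≤apart : count C∖B ≤ count (apartFrom u) + count (apartFrom v)
      C∖B≤apart = ≤-trans (count-mono apart-from-one) (count-∨ (apartFrom u) (apartFrom v))

    many-apart⇒B≤cutDeg : ∀ {v} → C∖B v ≡ true → 2 * δ∣C∣ ≤ q * count (apartFrom v) →
                          count B ≤ cutDeg v
    many-apart⇒B≤cutDeg {v} gv many =
      <⇒≤ (*-cancelˡ-< q (count B) (cutDeg v) (<-≤-trans B-small δ∣C∣≤))
      where
      open ≤-Reasoning
      δ∣C∣≤ : δ∣C∣ ≤ q * cutDeg v
      δ∣C∣≤ = +-cancelʳ-≤ δ∣C∣ δ∣C∣ (q * cutDeg v) (begin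
        δ∣C∣ + δ∣C∣             ≡⟨ cong (δ∣C∣ +_) (+-identityʳ δ∣C∣) ⟨
        2 * δ∣C∣                ≤⟨ many ⟩
        q * count (apartFrom v) ≤⟨ apartFrom-bound gv ⟩
        q * cutDeg v + δ∣C∣     ∎)

    separatedMinus≤cutPlus : countOrd separatedMinus ≤ countOrd cutPlus
    separatedMinus≤cutPlus =
      countOrd≤∑-sparse-heavy separatedMinus cutDeg {q} (≤-<-trans z≤n B-small) symmetric sparse heavy
      where
      symmetric : ∀ u v → separatedMinus u v ≡ separatedMinus v u
      symmetric u v rewrite minusC∖B-sym u v | together-sym u v = refl
      endpoints : ∀ {u v} → separatedMinus u v ≡ true →
                  C∖B u ≡ true × C∖B v ≡ true × isMinus (lab u v) ≡ true
      endpoints {u} {v} e = minusC∖B-elim (proj₁ (∧-elim (minusC∖B u v) e))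
      sparse : ∀ u → q * count (separatedMinus u) ≤ δ∣C∣
      sparse u with bool-cases (C∖B u)
      ... | inj₁ gu = let (cu , bu) = C∖B-elim gu in
        ≤-trans (*-monoʳ-≤ q (count-mono minusNbr)) (proj₁ (clean u cu bu))
        where
        minusNbr : ∀ w → separatedMinus u w ≡ true → minusNbrC u w ≡ true
        minusNbr w e = let (_ , gw , m) = endpoints e in ∧-intro m (proj₁ (C∖B-elim gw))
      ... | inj₂ ¬gu = ≤-trans (≤-reflexive (trans (cong (q *_) (count-none empty)) (*-zeroʳ q))) z≤n
        where
        empty : ∀ w → separatedMinus u w ≡ false
        empty w = ¬-not λ e → contradiction (trans (sym ¬gu) (proj₁ (endpoints e))) λ ()
      heavy : ∀ u v → separatedMinus u v ≡ true → 2 * δ∣C∣ ≤ q * (cutDeg u + cutDeg v)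
      heavy u v e = let (gu , gv , _) = endpoints e in
        apart-pair-heavy gu gv (not-injective (proj₂ (∧-elim (minusC∖B u v) e)))

    minusC∖B≤mistakesC∖B² : countOrd minusC∖B ≤ mistakesC∖B²
    minusC∖B≤mistakesC∖B² = begin
      countOrd minusC∖B                                  ≡⟨ countOrd-split minusC∖B together ⟩
      countOrd togetherMinus + countOrd separatedMinus   ≤⟨ +-monoʳ-≤ (countOrd togetherMinus)
                                                                      separatedMinus≤cutPlus ⟩
      countOrd togetherMinus + countOrd cutPlus          ≡⟨ countOrd-∨-disjoint together∩cut ⟨
      countOrd (λ u v → togetherMinus u v ∨ cutPlus u v) ≤⟨ countOrd-mono ⊆mistake ⟩
      mistakesC∖B²                                       ∎
      where
      open ≤-Reasoning
      togetherMinus : Fin n → Fin n → Bool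
      togetherMinus u v = minusC∖B u v ∧ together u v
      together∩cut : ∀ u v → togetherMinus u v ≡ true → cutPlus u v ≡ false
      together∩cut u v e = ¬-not λ c → contradiction (trans (sym (is-minus e)) (is-plus c)) λ ()
        where
        is-minus : togetherMinus u v ≡ true → lab u v ≡ minus
        is-minus t = isMinus⇒≡minus (proj₂ (proj₂ (minusC∖B-elim (proj₁ (∧-elim (minusC∖B u v) t)))))
        is-plus : cutPlus u v ≡ true → lab u v ≡ plus
        is-plus c = isPlus⇒≡plus
          (proj₁ (∧-elim (isPlus (lab u v)) (proj₂ (proj₂ (∧₃-elim (C∖B u) (C∖B v) c)))))
      ⊆mistake : ∀ u v → (togetherMinus u v ∨ cutPlus u v) ≡ true →
                 (C∖B u ∧ C∖B v ∧ mistake u v) ≡ true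
      ⊆mistake u v e with ∨-elim (togetherMinus u v) e
      ... | inj₂ c = cutPlus⇒mistake u v c
      ... | inj₁ j = let (e₁ , t) = ∧-elim (minusC∖B u v) j ; (gu , gv , m) = minusC∖B-elim e₁ in
        ∧-intro gu (∧-intro gv (∨-introˡ (∧-intro m t)))

    minusC∖B-pairs≤mistakes : countPairs minusC∖B ≤ 2 * mistakes lab cl
    minusC∖B-pairs≤mistakes = ≤-trans (*-cancelˡ-≤ 2 (begin
      2 * countPairs minusC∖B          ≤⟨ 2*countPairs≤countOrd minusC∖B minusC∖B-sym ⟩
      countOrd minusC∖B                ≤⟨ minusC∖B≤mistakesC∖B² ⟩
      mistakesC∖B²                     ≤⟨ m≤m+n mistakesC∖B² (2 * mistakesB×C∖B) ⟩
      mistakesC∖B² + 2 * mistakesB×C∖B ≤⟨ ordered-mistakes ⟩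
      2 * mistakes lab cl              ∎)) (m≤m+n (mistakes lab cl) _)
      where open ≤-Reasoning

    -- Each C∖B-endpoint v of R is apart from the vertices counted by T, so it has at least
    -- |B| cut ⟨+⟩ edges, which pay for its column of R.
    crossEdges≤cutPlus : (S T : Fin n → Bool) →
      (∀ {v w} → S v ≡ true → T w ≡ true → together v w ≡ false) →
      2 * δ∣C∣ ≤ q * count (λ w → C∖B w ∧ T w) →
      (R : Fin n → Fin n → Bool) →
      (∀ {b v} → R b v ≡ true → B b ≡ true × C∖B v ≡ true × S v ≡ true) →
      countOrd R ≤ countOrd cutPlus
    crossEdges≤cutPlus S T separated many R R⇒ =
      ≤-trans (≤-reflexive (countOrd-transpose R)) (∑-mono column)
      where
      column : ∀ v → count (λ b → R b v) ≤ cutDeg v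
      column v with bool-cases (C∖B v ∧ S v)
      ... | inj₁ e = let (gv , sv) = ∧-elim (C∖B v) e in
        ≤-trans (count-mono {P = λ b → R b v} {B} (λ b r → proj₁ (R⇒ r)))
                (many-apart⇒B≤cutDeg gv (≤-trans many (*-monoʳ-≤ q (T≤apart sv))))
        where
        T≤apart : S v ≡ true → count (λ w → C∖B w ∧ T w) ≤ count (apartFrom v)
        T≤apart sv = count-mono λ w e → let (gw , tw) = ∧-elim (C∖B w) e in
          ∧-intro gw (cong not (separated sv tw))
      ... | inj₂ e = ≤-trans (≤-reflexive (count-none {P = λ b → R b v} empty)) z≤n
        where
        empty : ∀ b → R b v ≡ false
        empty b = ¬-not λ r → let (_ , gv , sv) = R⇒ r in
          contradiction (trans (sym e) (∧-intro gv sv)) λ ()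

    module _ (isc : IsClustering B cl) (b₀ : Fin n) (bad₀ : B b₀ ≡ true) where

      together-bad : ∀ {b v} → B b ≡ true → together b v ≡ together b₀ v
      together-bad {b} {v} bad = cong (λ c → ⌊ c ≟ cl v ⌋) (isc b b₀ bad bad₀)

      inside outside : Fin n → Bool
      inside w = C∖B w ∧ together b₀ w
      outside w = C∖B w ∧ not (together b₀ w)

      inside-or-outside-large : 2 * δ∣C∣ ≤ q * count inside ⊎ 2 * δ∣C∣ ≤ q * count outside
      inside-or-outside-large = m+m≤n+o⇒m≤n⊎m≤o _ _ _ (begin
        2 * δ∣C∣ + 2 * δ∣C∣                  ≡⟨ 2*m+2*m≡4*m δ∣C∣ ⟩
        4 * δ∣C∣                             ≤⟨ C∖B-large ⟩
        q * count C∖B                        ≡⟨ cong (q *_) (count-split C∖B (together b₀)) ⟩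
        q * (count inside + count outside)   ≡⟨ *-distribˡ-+ q (count inside) (count outside) ⟩
        q * count inside + q * count outside ∎)
        where open ≤-Reasoning

      crossMinus≤-many-inside : 2 * δ∣C∣ ≤ q * count inside →
                                countOrd crossMinus ≤ mistakesB×C∖B + countOrd cutPlus
      crossMinus≤-many-inside many = begin
        countOrd crossMinus
          ≡⟨ countOrd-split crossMinus together ⟩
        countOrd (λ b v → crossMinus b v ∧ together b v) + countOrd separatedCross
          ≤⟨ +-mono-≤ (countOrd-mono together⇒mistake)
                      (crossEdges≤cutPlus (not ∘ together b₀) (together b₀) separated many _ R⇒) ⟩
        mistakesB×C∖B + countOrd cutPlus ∎
        where
        open ≤-Reasoning
        separatedCross : Fin n → Fin n → Bool
        separatedCross b v = crossMinus b v ∧ not (together b v)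
        together⇒mistake : ∀ b v → (crossMinus b v ∧ together b v) ≡ true →
                           (B b ∧ C∖B v ∧ mistake b v) ≡ true
        together⇒mistake b v e =
          let (e₁ , t) = ∧-elim (crossMinus b v) e ; (bad , gv , m) = ∧₃-elim (B b) (C∖B v) e₁
          in ∧-intro bad (∧-intro gv (∨-introˡ (∧-intro m t)))
        separated : ∀ {v w} → not (together b₀ v) ≡ true → together b₀ w ≡ true → together v w ≡ false
        separated sv tw = apart-intro λ eq → apart⇒≢ (not-injective sv) (trans (together⇒≡ tw) (sym eq))
        R⇒ : ∀ {b v} → separatedCross b v ≡ true →
             B b ≡ true × C∖B v ≡ true × not (together b₀ v) ≡ true
        R⇒ {b} {v} e =
          let (e₁ , nt) = ∧-elim (crossMinus b v) e ; (bad , gv , _) = ∧₃-elim (B b) (C∖B v) e₁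
          in bad , gv , trans (cong not (sym (together-bad bad))) nt

      crossMinus≤-many-outside : countOrd crossMinus ≤ countOrd crossPlus →
                                 2 * δ∣C∣ ≤ q * count outside →
                                 countOrd crossMinus ≤ mistakesB×C∖B + countOrd cutPlus
      crossMinus≤-many-outside minus≤plus many = begin
        countOrd crossMinus
          ≤⟨ minus≤plus ⟩
        countOrd crossPlus
          ≡⟨ countOrd-split crossPlus together ⟩
        countOrd togetherCross + countOrd (λ b v → crossPlus b v ∧ not (together b v))
          ≤⟨ +-mono-≤ (crossEdges≤cutPlus (together b₀) (not ∘ together b₀) separated many _ R⇒)
                      (countOrd-mono apart⇒mistake) ⟩
        countOrd cutPlus + mistakesB×C∖B
          ≡⟨ +-comm (countOrd cutPlus) mistakesB×C∖B ⟩
        mistakesB×C∖B + countOrd cutPlus ∎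
        where
        open ≤-Reasoning
        togetherCross : Fin n → Fin n → Bool
        togetherCross b v = crossPlus b v ∧ together b v
        apart⇒mistake : ∀ b v → (crossPlus b v ∧ not (together b v)) ≡ true →
                        (B b ∧ C∖B v ∧ mistake b v) ≡ true
        apart⇒mistake b v e =
          let (e₁ , nt) = ∧-elim (crossPlus b v) e ; (bad , gv , pl) = ∧₃-elim (B b) (C∖B v) e₁
          in ∧-intro bad (∧-intro gv (∨-introʳ (isMinus (lab b v) ∧ together b v) (∧-intro pl nt)))
        separated : ∀ {v w} → together b₀ v ≡ true → not (together b₀ w) ≡ true → together v w ≡ false
        separated sv tw = apart-intro λ eq → apart⇒≢ (not-injective tw) (trans (together⇒≡ sv) eq)
        R⇒ : ∀ {b v} → togetherCross b v ≡ true → B b ≡ true × C∖B v ≡ true × together b₀ v ≡ true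
        R⇒ {b} {v} e =
          let (e₁ , t) = ∧-elim (crossPlus b v) e ; (bad , gv , _) = ∧₃-elim (B b) (C∖B v) e₁
          in bad , gv , trans (sym (together-bad bad)) t

    crossMinus≤mistakes+cutPlus : IsClustering B cl → countOrd crossMinus ≤ countOrd crossPlus →
                                  countOrd crossMinus ≤ mistakesB×C∖B + countOrd cutPlus
    crossMinus≤mistakes+cutPlus isc minus≤plus with any? (λ b → B b ≟ᵇ true)
    ... | no no-bad =
      ≤-trans (countOrd-mono λ b v e → contradiction (b , proj₁ (∧-elim (B b) e)) no-bad) (m≤m+n _ _)
    ... | yes (b₀ , bad₀) =
      [ crossMinus≤-many-inside isc b₀ bad₀ , crossMinus≤-many-outside isc b₀ bad₀ minus≤plus ]
        (inside-or-outside-large isc b₀ bad₀)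

    minusC-pairs≤mistakes : IsClustering B cl → countOrd crossMinus ≤ countOrd crossPlus →
                            countPairs minusC ≤ 3 * mistakes lab cl
    minusC-pairs≤mistakes isc minus≤plus = *-cancelˡ-≤ 2 (begin
      2 * countPairs minusC
        ≤⟨ 2*countPairs≤countOrd minusC minusC-sym ⟩
      countOrd minusC
        ≤⟨ countOrd-mono minusC-cover ⟩
      countOrd (λ u v → minusC∖B u v ∨ crossMinus⇄ u v)
        ≤⟨ countOrd-∨ minusC∖B crossMinus⇄ ⟩
      countOrd minusC∖B + countOrd crossMinus⇄
        ≤⟨ +-monoʳ-≤ (countOrd minusC∖B) (countOrd-∨ crossMinus (λ u v → crossMinus v u)) ⟩
      countOrd minusC∖B + (countOrd crossMinus + countOrd (λ u v → crossMinus v u))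
        ≡⟨ cong (λ x → countOrd minusC∖B + (countOrd crossMinus + x)) (countOrd-transpose crossMinus) ⟨
      countOrd minusC∖B + (countOrd crossMinus + countOrd crossMinus)
        ≤⟨ +-mono-≤ minusC∖B≤mistakesC∖B² (+-mono-≤ crossMinus≤BG+GG crossMinus≤BG+GG) ⟩
      GG + ((BG + GG) + (BG + GG))
        ≤⟨ m≤m+n _ (4 * BG) ⟩
      GG + ((BG + GG) + (BG + GG)) + 4 * BG
        ≡⟨ collect GG BG ⟩
      3 * (GG + 2 * BG)
        ≤⟨ *-monoʳ-≤ 3 ordered-mistakes ⟩
      3 * (2 * mistakes lab cl)
        ≡⟨ 3*[2*m]≡2*[3*m] (mistakes lab cl) ⟩
      2 * (3 * mistakes lab cl) ∎)
      where
      open ≤-Reasoning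
      crossMinus⇄ : Fin n → Fin n → Bool
      crossMinus⇄ u v = crossMinus u v ∨ crossMinus v u
      GG BG : ℕ
      GG = mistakesC∖B²
      BG = mistakesB×C∖B
      crossMinus≤BG+GG : countOrd crossMinus ≤ BG + GG
      crossMinus≤BG+GG = ≤-trans (crossMinus≤mistakes+cutPlus isc minus≤plus)
                                 (+-monoʳ-≤ BG (countOrd-mono cutPlus⇒mistake))
      collect : ∀ a b → a + ((b + a) + (b + a)) + 4 * b ≡ 3 * (a + 2 * b)
      collect = solve-∀
      3*[2*m]≡2*[3*m] : ∀ m → 3 * (2 * m) ≡ 2 * (3 * m)
      3*[2*m]≡2*[3*m] = solve-∀

lemma1 : (n : ℕ) (lab : Fin n → Fin n → Label) (B : Fin n → Bool) → IsH lab B →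
    (p q : ℕ) → 0 < p → 5 * p ≤ q →
    (C : Fin n → Bool) → (∀ v → B v ≡ true → C v ≡ true) →
    CleanWithB lab B p q C →
    q * count B < p * count C →
    (∀ cl → IsClustering B cl →
    countPairs (λ u v → C u ∧ not (B u) ∧ C v ∧ not (B v) ∧ isMinus (lab u v))
    ≤ 2 * mistakes lab cl)
    × (Eminus lab B (λ u → C u ∧ not (B u)) ≤ Eplus lab B (λ u → C u ∧ not (B u)) →
    ∀ cl → IsClustering B cl →
    countPairs (λ u v → C u ∧ C v ∧ isMinus (lab u v)) ≤ 3 * mistakes lab cl)
lemma1 n lab B H p q _ 5p≤q C _ (clean , _) B-small =
  (λ cl _ → Cluster.minusC∖B-pairs≤mistakes cl 5p≤q B-small clean) ,
  (λ minus≤plus cl isc → Cluster.minusC-pairs≤mistakes cl 5p≤q B-small clean isc minus≤plus)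
  where
  module Cluster = CleanCluster lab B H p q C
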